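{- Let $n,r\geq 1$ and $m_1,\dots,m_r\geq 1$ be integers and let $D$ be the distance matrix of the weighted digraph $dC(n;m_1,\dots,m_r)^W$ with $|V|=(n+1)+\sum_{j=1}^r m_j$ vertices (notation as in the context). Then the sum of all cofactors of $D$ is $$\operatorname{cof} D=(-1)^{|V|-1}\,w_1^{\,n}\prod_{j=1}^r w_j^{\,m_j}.$$
   Context: For an $N\times N$ matrix $A$, $\operatorname{cof}A=\sum_{i,j}(-1)^{i+j}\det A(i\mid j)$, where $A(i\mid j)$ is $A$ with row $i$ and column $j$ deleted. The digraph $dC(n;m_1,\dots,m_r)$ has vertex set $V=\{u_0,\dots,u_n\}\cup\{v_i^{(j)}:1\le j\le r,\ 1\le i\le m_j\}$ and directed edges $u_{i-1}\to u_i$ ($1\le i\le n$) and, for each $j$, the directed path $u_n\to v_1^{(j)}\to\cdots\to v_{m_j}^{(j)}\to u_0$. Write $v_0^{(j)}=u_n$. Real edge weights: $W_i$ on $u_{i-1}\to u_i$; $W_i^{(j)}$ on $v_{i-1}^{(j)}\to v_i^{(j)}$ ($1\le i\le m_j$); $W_0^{(j)}$ on $v_{m_j}^{(j)}\to u_0$. Set $w_c=\sum_{i=1}^n W_i$, $\widehat w_j=\sum_{i=0}^{m_j}W_i^{(j)}$, $w_j=w_c+\widehat w_j$; the cycles are indexed so that $w_1\le\cdots\le w_r$. For $x\neq y$, $d(x,y)$ is the minimum total weight of a directed path without repeated vertices from $x$ to $y$, $d(x,x)=0$, and $D=[d(x,y)]$ with rows/columns ordered $u_0,\dots,u_n,v_1^{(1)},\dots,v_{m_1}^{(1)},\dots,v_1^{(r)},\dots,v_{m_r}^{(r)}$.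 -}

module Defs where

open import Level using (Level)
open import Data.Nat as ℕ using (ℕ; zero; suc)
open import Data.Fin as Fin using (Fin; zero; suc; toℕ; fromℕ; inject₁; punchIn; splitAt)
open import Data.Sum using (_⊎_; inj₁; inj₂)
open import Data.Product using (Σ; _,_; _×_; ∃)
open import Data.List using (List; []; _∷_)
open import Data.List.Relation.Unary.Unique.Propositional using (Unique)
open import Relation.Binary.PropositionalEquality using (_≡_)
open import Relation.Nullary using (¬_)
open import Algebra.Bundles using (CommutativeRing)

-- Purely combinatorial part: the digraph dC(n; m_1,…,m_r)
-- (cycles indexed by j : Fin r, i.e. j = 0 is the paper's cycle 1;
--  m j is the paper's m_{j+1}).

total : (r : ℕ) → (Fin r → ℕ) → ℕ
total zero    m = 0
total (suc r) m = m zero ℕ.+ total r (λ j → m (suc j))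

-- Vertices: u i  is u_i (0 ≤ i ≤ n);  v j k  is v_{k+1}^{(j+1)} (k : Fin (m j)).
data Vtx (n r : ℕ) (m : Fin r → ℕ) : Set where
  u : Fin (suc n) → Vtx n r m
  v : (j : Fin r) → Fin (m j) → Vtx n r m

data Edge {n r : ℕ} {m : Fin r → ℕ} : Vtx n r m → Vtx n r m → Set where
  -- u_{i} → u_{i+1}   (paper: u_{i-1} → u_i, weight W_i)
  eU     : (i : Fin n) → Edge (u (inject₁ i)) (u (suc i))
  eFirst : (j : Fin r) (k : Fin (m j)) → toℕ k ≡ 0 → Edge (u (fromℕ n)) (v j k)
  eMid   : (j : Fin r) (i k : Fin (m j)) → toℕ k ≡ suc (toℕ i) → Edge (v j i) (v j k)
  eLast  : (j : Fin r) (i : Fin (m j)) → suc (toℕ i) ≡ m j → Edge (v j i) (u zero)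

data Path {n r : ℕ} {m : Fin r → ℕ} : Vtx n r m → Vtx n r m → Set where
  []  : ∀ {x} → Path x x
  _∷_ : ∀ {x y z} → Edge x y → Path y z → Path x z

vertices : ∀ {n r m} {x y : Vtx n r m} → Path x y → List (Vtx n r m)
vertices {x = x} []      = x ∷ []
vertices {x = x} (e ∷ p) = x ∷ vertices p

IsSimple : ∀ {n r m} {x y : Vtx n r m} → Path x y → Set
IsSimple p = Unique (vertices p)

vblock : (r : ℕ) (m : Fin r → ℕ) → Fin (total r m) → Σ (Fin r) (λ j → Fin (m j))
vblock zero    m ()
vblock (suc r) m k with splitAt (m zero) k
... | inj₁ i  = zero , i
... | inj₂ k′ with vblock r (λ j → m (suc j)) k′
...   | j , i = suc j , i

enum : (n r : ℕ) (m : Fin r → ℕ) → Fin (suc n ℕ.+ total r m) → Vtx n r m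
enum n r m k with splitAt (suc n) k
... | inj₁ i = u i
... | inj₂ k′ with vblock r m k′
...   | j , i = v j i

module _ {c ℓ : Level} (R : CommutativeRing c ℓ) where
  open CommutativeRing R hiding (zero)

  sumF : (k : ℕ) → (Fin k → Carrier) → Carrier
  sumF zero    f = 0#
  sumF (suc k) f = f zero + sumF k (λ i → f (suc i))

  prodF : (k : ℕ) → (Fin k → Carrier) → Carrier
  prodF zero    f = 1#
  prodF (suc k) f = f zero * prodF k (λ i → f (suc i))

  pow : Carrier → ℕ → Carrier
  pow x zero    = 1#
  pow x (suc k) = x * pow x k

  sgn : ℕ → Carrier
  sgn k = pow (- 1#) k

  Matrix : ℕ → Set c
  Matrix k = Fin k → Fin k → Carrier

  minor : ∀ {k} → Matrix (suc k) → Fin (suc k) → Fin (suc k) → Matrix k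
  minor A i j a b = A (punchIn i a) (punchIn j b)

  det : (k : ℕ) → Matrix k → Carrier
  det zero    A = 1#
  det (suc k) A = sumF (suc k) (λ j → sgn (toℕ j) * (A zero j * det k (minor A zero j)))

  cof : (k : ℕ) → Matrix (suc k) → Carrier
  cof k A = sumF (suc k) (λ i → sumF (suc k) (λ j →
              sgn (toℕ i ℕ.+ toℕ j) * det k (minor A i j)))

  -- W i is the paper's W_{i+1} (weight of u_i → u_{i+1});
  -- Wv j zero is W_0^{(j)} (weight of v_{m_j}^{(j)} → u_0) and
  -- Wv j (suc k) is W_{k+1}^{(j)} (weight of the edge entering v_{k+1}^{(j)}).
  module Weighted {n r : ℕ} {m : Fin r → ℕ}
                  (W : Fin n → Carrier)
                  (Wv : (j : Fin r) → Fin (suc (m j)) → Carrier) where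

    edgeWeight : {x y : Vtx n r m} → Edge x y → Carrier
    edgeWeight (eU i)           = W i
    edgeWeight (eFirst j k _)   = Wv j (suc k)
    edgeWeight (eMid j i k _)   = Wv j (suc k)
    edgeWeight (eLast j i _)    = Wv j zero

    pathWeight : {x y : Vtx n r m} → Path x y → Carrier
    pathWeight []      = 0#
    pathWeight (e ∷ p) = edgeWeight e + pathWeight p

    wc : Carrier
    wc = sumF n W

    ŵ : Fin r → Carrier
    ŵ j = sumF (suc (m j)) (Wv j)

    w : Fin r → Carrier
    w j = wc + ŵ j

    IsMinPathWeight : ∀ {ℓ′} → (Carrier → Carrier → Set ℓ′) →
                      Vtx n r m → Vtx n r m → Carrier → Set _
    IsMinPathWeight _≤_ x y d =
      (Σ (Path x y) λ p → IsSimple p × (pathWeight p ≈ d)) ×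
      ((p : Path x y) → IsSimple p → d ≤ pathWeight p)

    IsDistanceMatrix : ∀ {ℓ′} → (Carrier → Carrier → Set ℓ′) →
                       Matrix (suc n ℕ.+ total r m) → Set _
    IsDistanceMatrix _≤_ D = ∀ a b →
      (enum n r m a ≡ enum n r m b → D a b ≈ 0#) ×
      (¬ (enum n r m a ≡ enum n r m b) →
         IsMinPathWeight _≤_ (enum n r m a) (enum n r m b) (D a b))

module Submission where

-- Take the potential φ(u_i) = W_1 + ⋯ + W_i and φ(v_k^(j)) = w_c + W_1^(j) + ⋯ + W_k^(j).
-- Every edge x → y weighs φ(y) − φ(x), except that the closing edge v_{m_j}^(j) → u_0 weighs
-- w_j more.  A simple path visits u_0 at most once, so it uses at most one closing edge, and
-- none exactly when its end is "forward" of its start.  Hence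
-- d(x,y) = J(x,y) + φ(y) − φ(x), where J(x,y) = 0 if y is forward of x and otherwise
-- J(x,y) = w_j if x lies on cycle j and J(x,y) = w_1 if x = u_i (go around the lightest cycle).
-- Adding constants to the rows or to the columns of a matrix does not change the sum of its
-- cofactors, so cof D = cof J.  In the vertex order of the statement row u_0 of J vanishes, and
-- after subtracting J's jump from every other row the matrix becomes triangular with diagonal
-- −(jump), which gives cof D = (−w_1)^n ∏_j (−w_j)^{m_j}.

open import Defs using (total; sumF; prodF; pow; sgn; Matrix; minor; det; cof; vblock; enum; module Weighted)
open import Level using (Level; _⊔_)
open import Algebra.Bundles using (CommutativeRing)
open import Data.Bool using (if_then_else_)
open import Data.Empty using (⊥; ⊥-elim)
open import Data.Fin as Fin using (Fin; zero; suc; toℕ; fromℕ; fromℕ<; inject₁; punchIn)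
import Data.Fin.Properties as Fin
open import Data.Integer as ℤ using (ℤ; +_; -[1+_])
import Data.Integer.Properties as ℤ
open import Data.List.Membership.Propositional using (_∈_)
open import Data.List.Relation.Unary.All as All using (All)
import Data.List.Relation.Unary.AllPairs as AllPairs
open import Data.List.Relation.Unary.Any using (here; there)
open import Data.Maybe using (Maybe; just; nothing)
open import Data.Nat as ℕ using (ℕ; zero; suc)
import Data.Nat.Properties as ℕ
open import Data.Product using (Σ; _,_; proj₁; proj₂)
open import Data.Sign as Sign using (Sign)
open import Data.Sum using (_⊎_; inj₁; inj₂)
open import Data.Unit using (⊤; tt)
import Data.Vec.Functional as Vector
open import Function using (_∘_)
open import Relation.Binary.PropositionalEquality as ≡ using (_≡_; _≢_)
open import Relation.Binary.Structures using (IsPartialOrder; IsTotalOrder)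
open import Relation.Nullary using (¬_; Dec; yes; no; does; contradiction)

-- The ring solver takes coefficients from a ring mapped homomorphically into R;
-- the integers map into every commutative ring.
module IntegerCoefficientSolver {c ℓ} (R : CommutativeRing c ℓ) where
  open CommutativeRing R
  open import Relation.Binary.Reasoning.Setoid setoid
  open import Algebra.Properties.Ring ring using (-‿involutive; -0#≈0#; -1*x≈-x)
  open import Algebra.Properties.Semiring.Mult.TCOptimised semiring using (_×_; ×-homo-+; ×1-homo-*)
  open import Algebra.Properties.AbelianGroup +-abelianGroup using (⁻¹-∙-comm)
  open import Algebra.Properties.CommutativeSemigroup +-commutativeSemigroup using (interchange)
  open import Algebra.Properties.CommutativeSemigroup *-commutativeSemigroup
    using () renaming (interchange to *-interchange)
  import Algebra.Solver.Ring.AlmostCommutativeRing as ACR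

  embed : ℤ → Carrier
  embed (+ n)    = n × 1#
  embed -[1+ n ] = - (suc n × 1#)

  sign : Sign → Carrier
  sign Sign.+ = 1#
  sign Sign.- = - 1#

  private
    -‿shift : ∀ a x y → x - y ≈ (a + x) - (a + y)
    -‿shift a x y = begin
      x - y                 ≈⟨ +-identityˡ _ ⟨
      0# + (x - y)          ≈⟨ +-congʳ (-‿inverseʳ a) ⟨
      (a - a) + (x - y)     ≈⟨ interchange a (- a) x (- y) ⟩
      (a + x) + (- a - y)   ≈⟨ +-congˡ (⁻¹-∙-comm a y) ⟩
      (a + x) - (a + y)     ∎

  embed-⊖ : ∀ m n → embed (m ℤ.⊖ n) ≈ m × 1# - n × 1#
  embed-⊖ zero    zero    = sym (-‿inverseʳ 0#)
  embed-⊖ zero    (suc n) = sym (+-identityˡ _)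
  embed-⊖ (suc m) zero    = sym (trans (+-congˡ -0#≈0#) (+-identityʳ _))
  embed-⊖ (suc m) (suc n) = begin
    embed (suc m ℤ.⊖ suc n)   ≡⟨ ≡.cong embed (ℤ.[1+m]⊖[1+n]≡m⊖n m n) ⟩
    embed (m ℤ.⊖ n)           ≈⟨ embed-⊖ m n ⟩
    m × 1# - n × 1#           ≈⟨ -‿shift 1# _ _ ⟩
    (1# + m × 1#) - (1# + n × 1#)
      ≈⟨ +-cong (×-homo-+ 1# 1 m) (-‿cong (×-homo-+ 1# 1 n)) ⟨
    suc m × 1# - suc n × 1#   ∎

  embed-+ : ∀ i j → embed (i ℤ.+ j) ≈ embed i + embed j
  embed-+ (+ m)    (+ n)    = ×-homo-+ 1# m n
  embed-+ (+ m)    -[1+ n ] = embed-⊖ m (suc n)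
  embed-+ -[1+ m ] (+ n)    = trans (embed-⊖ n (suc m)) (+-comm _ _)
  embed-+ -[1+ m ] -[1+ n ] = begin
    - (suc (suc (m ℕ.+ n)) × 1#)   ≡⟨ ≡.cong (λ k → - (k × 1#)) (≡.sym (ℕ.+-suc (suc m) n)) ⟩
    - ((suc m ℕ.+ suc n) × 1#)     ≈⟨ -‿cong (×-homo-+ 1# (suc m) (suc n)) ⟩
    - (suc m × 1# + suc n × 1#)    ≈⟨ ⁻¹-∙-comm _ _ ⟨
    embed -[1+ m ] + embed -[1+ n ] ∎

  embed-neg : ∀ i → embed (ℤ.- i) ≈ - embed i
  embed-neg (+ zero)  = sym -0#≈0#
  embed-neg (+ suc n) = refl
  embed-neg -[1+ n ]  = sym (-‿involutive _)

  embed-◃ : ∀ s k → embed (s ℤ.◃ k) ≈ sign s * k × 1#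
  embed-◃ s       zero    = sym (zeroʳ _)
  embed-◃ Sign.+ (suc k) = sym (*-identityˡ _)
  embed-◃ Sign.- (suc k) = sym (-1*x≈-x _)

  embed-sign-abs : ∀ i → embed i ≈ sign (ℤ.sign i) * ℤ.∣ i ∣ × 1#
  embed-sign-abs (+ n)    = sym (*-identityˡ _)
  embed-sign-abs -[1+ n ] = sym (-1*x≈-x _)

  sign-* : ∀ s t → sign (s Sign.* t) ≈ sign s * sign t
  sign-* Sign.+ Sign.+ = sym (*-identityˡ _)
  sign-* Sign.+ Sign.- = sym (*-identityˡ _)
  sign-* Sign.- Sign.+ = sym (*-identityʳ _)
  sign-* Sign.- Sign.- = sym (trans (-1*x≈-x _) (-‿involutive _))

  embed-* : ∀ i j → embed (i ℤ.* j) ≈ embed i * embed j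
  embed-* i j = begin
    embed (i ℤ.* j)
      ≈⟨ embed-◃ (ℤ.sign i Sign.* ℤ.sign j) (ℤ.∣ i ∣ ℕ.* ℤ.∣ j ∣) ⟩
    sign (ℤ.sign i Sign.* ℤ.sign j) * (ℤ.∣ i ∣ ℕ.* ℤ.∣ j ∣) × 1#
      ≈⟨ *-cong (sign-* (ℤ.sign i) (ℤ.sign j)) (×1-homo-* ℤ.∣ i ∣ ℤ.∣ j ∣) ⟩
    (sign (ℤ.sign i) * sign (ℤ.sign j)) * (ℤ.∣ i ∣ × 1# * ℤ.∣ j ∣ × 1#)
      ≈⟨ *-interchange _ _ _ _ ⟩
    (sign (ℤ.sign i) * ℤ.∣ i ∣ × 1#) * (sign (ℤ.sign j) * ℤ.∣ j ∣ × 1#)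
      ≈⟨ *-cong (embed-sign-abs i) (embed-sign-abs j) ⟨
    embed i * embed j ∎

  embed-homomorphism : ℤ.+-*-rawRing ACR.-Raw-AlmostCommutative⟶ ACR.fromCommutativeRing R
  embed-homomorphism = record
    { ⟦_⟧    = embed
    ; +-homo = embed-+
    ; *-homo = embed-*
    ; -‿homo = embed-neg
    ; 0-homo = refl
    ; 1-homo = refl
    }

  private
    embed-≟ : ∀ i j → Maybe (embed i ≈ embed j)
    embed-≟ i j with i ℤ.≟ j
    ... | yes ≡.refl = just refl
    ... | no _       = nothing

  open import Algebra.Solver.Ring ℤ.+-*-rawRing (ACR.fromCommutativeRing R)
    embed-homomorphism embed-≟ public

module SumsAndProducts {c ℓ} (R : CommutativeRing c ℓ) where
  open CommutativeRing R hiding (zero)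
  open import Relation.Binary.Reasoning.Setoid setoid
  open import Algebra.Properties.CommutativeSemigroup +-commutativeSemigroup using (interchange)
  open import Algebra.Properties.CommutativeSemigroup *-commutativeSemigroup
    using () renaming (interchange to *-interchange)
  open IntegerCoefficientSolver R using (solve; _:*_; :-_; con; _:=_)

  sumF-cong : ∀ k {f g : Fin k → Carrier} → (∀ i → f i ≈ g i) → sumF R k f ≈ sumF R k g
  sumF-cong zero    f≈g = refl
  sumF-cong (suc k) f≈g = +-cong (f≈g zero) (sumF-cong k (λ i → f≈g (suc i)))

  sumF-zero : ∀ k {f : Fin k → Carrier} → (∀ i → f i ≈ 0#) → sumF R k f ≈ 0#
  sumF-zero zero    f≈0 = refl
  sumF-zero (suc k) f≈0 = trans (+-cong (f≈0 zero) (sumF-zero k (λ i → f≈0 (suc i)))) (+-identityˡ 0#)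

  sumF-distrib-+ : ∀ k (f g : Fin k → Carrier) →
                   sumF R k (λ i → f i + g i) ≈ sumF R k f + sumF R k g
  sumF-distrib-+ zero    f g = sym (+-identityˡ 0#)
  sumF-distrib-+ (suc k) f g = trans
    (+-congˡ (sumF-distrib-+ k (λ i → f (suc i)) (λ i → g (suc i))))
    (interchange _ _ _ _)

  *-distribˡ-sumF : ∀ k x (f : Fin k → Carrier) → x * sumF R k f ≈ sumF R k (λ i → x * f i)
  *-distribˡ-sumF zero    x f = zeroʳ x
  *-distribˡ-sumF (suc k) x f = trans (distribˡ x _ _) (+-congˡ (*-distribˡ-sumF k x (λ i → f (suc i))))

  sumF-comm : ∀ k l (f : Fin k → Fin l → Carrier) →
              sumF R k (λ i → sumF R l (f i)) ≈ sumF R l (λ j → sumF R k (λ i → f i j))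
  sumF-comm zero    l f = sym (sumF-zero l (λ _ → refl))
  sumF-comm (suc k) l f = trans (+-congˡ (sumF-comm k l (λ i → f (suc i))))
                                (sym (sumF-distrib-+ l (f zero) _))

  sumF-linear : ∀ k α β {f g h : Fin k → Carrier} → (∀ i → f i ≈ α * g i + β * h i) →
                sumF R k f ≈ α * sumF R k g + β * sumF R k h
  sumF-linear k α β {f} {g} {h} f≈ = begin
    sumF R k f                                          ≈⟨ sumF-cong k f≈ ⟩
    sumF R k (λ i → α * g i + β * h i)                  ≈⟨ sumF-distrib-+ k _ _ ⟩
    sumF R k (λ i → α * g i) + sumF R k (λ i → β * h i)
      ≈⟨ +-cong (*-distribˡ-sumF k α g) (*-distribˡ-sumF k β h) ⟨
    α * sumF R k g + β * sumF R k h                     ∎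

  prodF-cong : ∀ k {f g : Fin k → Carrier} → (∀ i → f i ≈ g i) → prodF R k f ≈ prodF R k g
  prodF-cong zero    f≈g = refl
  prodF-cong (suc k) f≈g = *-cong (f≈g zero) (prodF-cong k (λ i → f≈g (suc i)))

  prodF-++ : ∀ a b (f : Fin (a ℕ.+ b) → Carrier) →
             prodF R (a ℕ.+ b) f ≈ prodF R a (λ i → f (i Fin.↑ˡ b)) * prodF R b (λ j → f (a Fin.↑ʳ j))
  prodF-++ zero    b f = sym (*-identityˡ _)
  prodF-++ (suc a) b f = trans (*-congˡ (prodF-++ a b (λ i → f (suc i)))) (sym (*-assoc _ _ _))

  prodF-const : ∀ k x → prodF R k (λ _ → x) ≈ pow R x k
  prodF-const zero    x = refl
  prodF-const (suc k) x = *-congˡ (prodF-const k x)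

  sgn-+ : ∀ a b → sgn R (a ℕ.+ b) ≈ sgn R a * sgn R b
  sgn-+ zero    b = sym (*-identityˡ _)
  sgn-+ (suc a) b = trans (*-congˡ (sgn-+ a b)) (sym (*-assoc _ _ _))

  pow-neg : ∀ x k → pow R (- x) k ≈ sgn R k * pow R x k
  pow-neg x zero    = sym (*-identityˡ _)
  pow-neg x (suc k) = trans (*-congˡ (pow-neg x k))
    (solve 3 (λ x s p → (:- x) :* (s :* p) := ((:- con (+ 1)) :* s) :* (x :* p)) refl x (sgn R k) (pow R x k))

  prodF-sgn : ∀ r (m : Fin r → ℕ) (f : Fin r → Carrier) →
              prodF R r (λ j → sgn R (m j) * f j) ≈ sgn R (total r m) * prodF R r f
  prodF-sgn zero    m f = sym (*-identityˡ _)
  prodF-sgn (suc r) m f = begin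
    (sgn R (m zero) * f zero) * prodF R r (λ j → sgn R (m (suc j)) * f (suc j))
      ≈⟨ *-congˡ (prodF-sgn r (λ j → m (suc j)) (λ j → f (suc j))) ⟩
    (sgn R (m zero) * f zero) * (sgn R (total r (λ j → m (suc j))) * prodF R r (λ j → f (suc j)))
      ≈⟨ *-interchange _ _ _ _ ⟩
    (sgn R (m zero) * sgn R (total r (λ j → m (suc j)))) * prodF R (suc r) f
      ≈⟨ *-congʳ (sgn-+ (m zero) _) ⟨
    sgn R (total (suc r) m) * prodF R (suc r) f ∎

module Determinants {c ℓ} (R : CommutativeRing c ℓ) where
  open CommutativeRing R hiding (zero)
  open import Relation.Binary.Reasoning.Setoid setoid
  open import Algebra.Properties.Ring ring using (-‿involutive)
  open import Algebra.Properties.Group +-group using (inverseʳ-unique)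
  open IntegerCoefficientSolver R using (solve; _:+_; _:*_; :-_; con; _:=_)
  open SumsAndProducts R
  open Vector using (_∷_)

  Row : ℕ → Set c
  Row k = Fin k → Carrier

  infix 10 _ᵀ
  _ᵀ : ∀ {k} → Matrix R k → Matrix R k
  (A ᵀ) a b = A b a

  laplaceTerm : ∀ {k} → Matrix R (suc k) → Fin (suc k) → Carrier
  laplaceTerm {k} A j = sgn R (toℕ j) * (A zero j * det R k (minor R A zero j))

  columnTerm : ∀ {k} → Matrix R (suc k) → Fin (suc k) → Carrier
  columnTerm {k} A i = sgn R (toℕ i) * (A i zero * det R k (minor R A i zero))

  det-cong : ∀ k {A B : Matrix R k} → (∀ a b → A a b ≈ B a b) → det R k A ≈ det R k B
  det-cong zero    A≈B = refl
  det-cong (suc k) {A} {B} A≈B = sumF-cong (suc k) {laplaceTerm A} {laplaceTerm B} λ j →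
    *-congˡ (*-cong (A≈B zero j) (det-cong k (λ a b → A≈B (suc a) (punchIn j b))))

  private
    *-distribˡ-sumF₂ : ∀ k x y (f : Fin k → Carrier) →
                       x * (y * sumF R k f) ≈ sumF R k (λ i → x * (y * f i))
    *-distribˡ-sumF₂ k x y f =
      trans (*-congˡ (*-distribˡ-sumF k y f)) (*-distribˡ-sumF k x (λ i → y * f i))

    *-zero-nested : ∀ x y {z} → z ≈ 0# → x * (y * z) ≈ 0#
    *-zero-nested x y z≈0 = trans (*-congˡ (trans (*-congˡ z≈0) (zeroʳ y))) (zeroʳ x)

  -- Expanding every first-row minor along its first column gives a double sum
  -- that is symmetric in the roles of row 0 and column 0.
  det-expandColumn₀ : ∀ k (A : Matrix R (suc k)) → det R (suc k) A ≈ sumF R (suc k) (columnTerm A)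
  det-expandColumn₀ zero    A = refl
  det-expandColumn₀ (suc k) A = +-congˡ (begin
    sumF R (suc k) (λ l → laplaceTerm A (suc l))
      ≈⟨ sumF-cong (suc k) {λ l → laplaceTerm A (suc l)} (λ l → trans
           (*-congˡ (*-congˡ (det-expandColumn₀ k (minor R A zero (suc l)))))
           (*-distribˡ-sumF₂ (suc k) _ _ (λ i → sgn R (toℕ i) * (A (suc i) zero * Δ i l)))) ⟩
    sumF R (suc k) (λ l → sumF R (suc k) (λ i → term l i))
      ≈⟨ sumF-comm (suc k) (suc k) term ⟩
    sumF R (suc k) (λ i → sumF R (suc k) (λ l → term l i))
      ≈⟨ sumF-cong (suc k) {g = λ i → columnTerm A (suc i)} (λ i → trans
           (sumF-cong (suc k) (λ l →
             reorder (sgn R (toℕ l)) (A zero (suc l)) (sgn R (toℕ i)) (A (suc i) zero) (Δ i l)))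
           (sym (*-distribˡ-sumF₂ (suc k) _ _ (λ l → sgn R (toℕ l) * (A zero (suc l) * Δ i l))))) ⟩
    sumF R (suc k) (λ i → columnTerm A (suc i)) ∎)
    where
    Δ : Fin (suc k) → Fin (suc k) → Carrier
    Δ i l = det R k (λ a b → A (suc (punchIn i a)) (suc (punchIn l b)))
    term : Fin (suc k) → Fin (suc k) → Carrier
    term l i = sgn R (suc (toℕ l)) * (A zero (suc l) * (sgn R (toℕ i) * (A (suc i) zero * Δ i l)))
    reorder : ∀ s a t b d → (- 1# * s) * (a * (t * (b * d))) ≈ (- 1# * t) * (b * (s * (a * d)))
    reorder = solve 5 (λ s a t b d →
      ((:- con (+ 1)) :* s) :* (a :* (t :* (b :* d))) := ((:- con (+ 1)) :* t) :* (b :* (s :* (a :* d)))) refl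

  det-transpose : ∀ k (A : Matrix R k) → det R k (A ᵀ) ≈ det R k A
  det-transpose zero    A = refl
  det-transpose (suc k) A = trans
    (sumF-cong (suc k) {laplaceTerm (A ᵀ)} {columnTerm A}
      (λ j → *-congˡ (*-congˡ (det-transpose k (minor R A j zero)))))
    (sym (det-expandColumn₀ k A))

  det-rowLinear : ∀ k (A B C : Matrix R k) (t : Fin k) α β →
    (∀ a → a ≢ t → ∀ b → A a b ≈ B a b) → (∀ a → a ≢ t → ∀ b → A a b ≈ C a b) →
    (∀ b → A t b ≈ α * B t b + β * C t b) →
    det R k A ≈ α * det R k B + β * det R k C
  det-rowLinear (suc k) A B C zero α β A≈B A≈C Aₜ =
    sumF-linear (suc k) α β {g = laplaceTerm B} {laplaceTerm C} (λ j → trans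
      (*-congˡ (*-cong (Aₜ j) refl))
      (distribute (sgn R (toℕ j)) (B zero j) (C zero j)
        (det-cong k (λ a b → A≈B (suc a) (λ ()) _)) (det-cong k (λ a b → A≈C (suc a) (λ ()) _))))
    where
    distribute : ∀ s b c {d x y} → d ≈ x → d ≈ y →
                 s * ((α * b + β * c) * d) ≈ α * (s * (b * x)) + β * (s * (c * y))
    distribute s b c {d} d≈x d≈y = trans
      (solve 6 (λ α β s b c d → s :* ((α :* b :+ β :* c) :* d) := α :* (s :* (b :* d)) :+ β :* (s :* (c :* d)))
        refl α β s b c d)
      (+-cong (*-congˡ (*-congˡ (*-congˡ d≈x))) (*-congˡ (*-congˡ (*-congˡ d≈y))))
  det-rowLinear (suc k) A B C (suc t) α β A≈B A≈C Aₜ =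
    sumF-linear (suc k) α β {g = laplaceTerm B} {laplaceTerm C} (λ j → trans
      (*-congˡ (*-congˡ (det-rowLinear k (minor R A zero j) (minor R B zero j) (minor R C zero j) t α β
        (λ a a≢t b → A≈B (suc a) (λ eq → a≢t (Fin.suc-injective eq)) _)
        (λ a a≢t b → A≈C (suc a) (λ eq → a≢t (Fin.suc-injective eq)) _)
        (λ b → Aₜ _))))
      (distribute (sgn R (toℕ j)) (A≈B zero (λ ()) j) (A≈C zero (λ ()) j)))
    where
    distribute : ∀ s {a b c x y} → a ≈ b → a ≈ c →
                 s * (a * (α * x + β * y)) ≈ α * (s * (b * x)) + β * (s * (c * y))
    distribute s {a} {x = x} {y} a≈b a≈c = trans
      (solve 6 (λ α β s a x y → s :* (a :* (α :* x :+ β :* y)) := α :* (s :* (a :* x)) :+ β :* (s :* (a :* y)))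
        refl α β s a x y)
      (+-cong (*-congˡ (*-congˡ (*-congʳ a≈b))) (*-congˡ (*-congˡ (*-congʳ a≈c))))

  det-rowAdditive : ∀ k (A B C : Matrix R k) (t : Fin k) →
    (∀ a → a ≢ t → ∀ b → A a b ≈ B a b) → (∀ a → a ≢ t → ∀ b → A a b ≈ C a b) →
    (∀ b → A t b ≈ B t b + C t b) → det R k A ≈ det R k B + det R k C
  det-rowAdditive k A B C t A≈B A≈C Aₜ = trans
    (det-rowLinear k A B C t 1# 1# A≈B A≈C (λ b → trans (Aₜ b) (sym (+-cong (*-identityˡ _) (*-identityˡ _)))))
    (+-cong (*-identityˡ _) (*-identityˡ _))

  det-zeroRow : ∀ k (A : Matrix R k) t → (∀ b → A t b ≈ 0#) → det R k A ≈ 0#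
  det-zeroRow k A t Aₜ≈0 = trans
    (det-rowLinear k A A A t 0# 0# (λ _ _ _ → refl) (λ _ _ _ → refl)
      (λ b → trans (Aₜ≈0 b) (sym zero+zero)))
    zero+zero
    where
    zero+zero : ∀ {x y} → 0# * x + 0# * y ≈ 0#
    zero+zero = trans (+-cong (zeroˡ _) (zeroˡ _)) (+-identityˡ 0#)

  -- Along column 0 the terms of rows 0 and 1 cancel, and the other minors again
  -- have two equal first rows.
  det-equalRows₀₁ : ∀ k (A : Matrix R (suc (suc k))) →
    (∀ b → A zero b ≈ A (suc zero) b) → det R (suc (suc k)) A ≈ 0#
  det-equalRows₀₁ k A A₀≈A₁ = begin
    det R (suc (suc k)) A
      ≈⟨ det-expandColumn₀ (suc k) A ⟩
    sgn R 0 * (A zero zero * d₀) + (sgn R 1 * (A (suc zero) zero * d₁) + rest k A)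
      ≈⟨ +-cong (*-congˡ (*-cong (A₀≈A₁ zero) d₀≈d₁)) (+-congˡ (rest≈0 k A A₀≈A₁)) ⟩
    sgn R 0 * (A (suc zero) zero * d₁) + (sgn R 1 * (A (suc zero) zero * d₁) + 0#)
      ≈⟨ solve 2 (λ a d →
           con (+ 1) :* (a :* d) :+ (((:- con (+ 1)) :* con (+ 1)) :* (a :* d) :+ con (+ 0)) := con (+ 0))
           refl (A (suc zero) zero) d₁ ⟩
    0# ∎
    where
    d₀ d₁ : Carrier
    d₀ = det R (suc k) (minor R A zero zero)
    d₁ = det R (suc k) (minor R A (suc zero) zero)
    d₀≈d₁ : d₀ ≈ d₁
    d₀≈d₁ = det-cong (suc k) {minor R A zero zero} {minor R A (suc zero) zero}
      λ { zero b → sym (A₀≈A₁ (suc b)) ; (suc a) b → refl }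
    rest : ∀ k → Matrix R (suc (suc k)) → Carrier
    rest k A = sumF R k (λ i → sgn R (suc (suc (toℕ i))) *
                 (A (suc (suc i)) zero * det R (suc k) (minor R A (suc (suc i)) zero)))
    rest≈0 : ∀ k (A : Matrix R (suc (suc k))) → (∀ b → A zero b ≈ A (suc zero) b) → rest k A ≈ 0#
    rest≈0 zero    A _       = refl
    rest≈0 (suc k) A A₀≈A₁ = sumF-zero (suc k) λ i →
      *-zero-nested (sgn R (suc (suc (toℕ i)))) (A (suc (suc i)) zero)
        (det-equalRows₀₁ k (minor R A (suc (suc i)) zero) (λ b → A₀≈A₁ (suc b)))

  private
    sameTail : ∀ {k l} {x y : Row l} (M : Fin k → Row l) a → a ≢ zero → ∀ b → (x ∷ M) a b ≈ (y ∷ M) a b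
    sameTail M zero    0≢0 _ = ⊥-elim (0≢0 ≡.refl)
    sameTail M (suc a) _   _ = refl

  swap₀₁ : ∀ {k} → Matrix R (suc (suc k)) → Matrix R (suc (suc k))
  swap₀₁ A = A (suc zero) ∷ A zero ∷ (λ a → A (suc (suc a)))

  det-swap₀₁ : ∀ k (A : Matrix R (suc (suc k))) → det R (suc (suc k)) (swap₀₁ A) ≈ - det R (suc (suc k)) A
  det-swap₀₁ k A = trans
    (inverseʳ-unique (d (A zero) (A (suc zero))) _ (begin
      d x y + d y x                       ≈⟨ +-cong (+-identityˡ _) (+-identityʳ _) ⟨
      (0# + d x y) + (d y x + 0#)         ≈⟨ +-cong (+-congʳ (d-diag x)) (+-congˡ (d-diag y)) ⟨
      (d x x + d x y) + (d y x + d y y)   ≈⟨ +-cong (additive₁ x) (additive₁ y) ⟨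
      d x s + d y s                       ≈⟨ additive₀ s ⟨
      d s s                               ≈⟨ d-diag s ⟩
      0#                                  ∎))
    (-‿cong (det-cong (suc (suc k)) {x ∷ y ∷ rest} {A}
      λ { zero b → refl ; (suc zero) b → refl ; (suc (suc a)) b → refl }))
    where
    rest : Fin k → Row (suc (suc k))
    rest a = A (suc (suc a))
    x y s : Row (suc (suc k))
    x = A zero
    y = A (suc zero)
    s b = x b + y b
    d : Row (suc (suc k)) → Row (suc (suc k)) → Carrier
    d x y = det R (suc (suc k)) (x ∷ y ∷ rest)
    d-diag : ∀ z → d z z ≈ 0#
    d-diag z = det-equalRows₀₁ k (z ∷ z ∷ rest) (λ _ → refl)
    additive₀ : ∀ z → d s z ≈ d x z + d y z
    additive₀ z = det-rowAdditive _ (s ∷ z ∷ rest) (x ∷ z ∷ rest) (y ∷ z ∷ rest) zero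
      (sameTail _) (sameTail _) (λ _ → refl)
    additive₁ : ∀ z → d z s ≈ d z x + d z y
    additive₁ z = det-rowAdditive _ (z ∷ s ∷ rest) (z ∷ x ∷ rest) (z ∷ y ∷ rest) (suc zero)
      off₁ off₁ (λ _ → refl)
      where
      off₁ : ∀ {v w} a → a ≢ suc zero → ∀ b → (z ∷ v ∷ rest) a b ≈ (z ∷ w ∷ rest) a b
      off₁ zero          _   _ = refl
      off₁ (suc zero)    1≢1 _ = ⊥-elim (1≢1 ≡.refl)
      off₁ (suc (suc a)) _   _ = refl

  -- Swapping rows 0 and 1 moves the modified row to the top; expanding along it,
  -- every minor is again of the form of the lemma, one size smaller.
  det-addMultiplesOfTop : ∀ k (A B : Matrix R (suc k)) (g : Fin k → Carrier) →
    (∀ b → B zero b ≈ A zero b) → (∀ a b → B (suc a) b ≈ A (suc a) b + g a * A zero b) →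
    det R (suc k) B ≈ det R (suc k) A
  det-addMultiplesOfTop zero    A B g B₀≈A₀ _   = det-cong 1 {B} {A} λ { zero b → B₀≈A₀ b }
  det-addMultiplesOfTop (suc k) A B g B₀≈A₀ B₊≈ = begin
    det R _ B                ≈⟨ -‿involutive _ ⟨
    - - det R _ B            ≈⟨ -‿cong (det-swap₀₁ k B) ⟨
    - det R _ (swap₀₁ B)     ≈⟨ -‿cong swapB≈C ⟩
    - det R _ C              ≈⟨ -‿cong C≈swapA ⟩
    - det R _ (swap₀₁ A)     ≈⟨ -‿cong (det-swap₀₁ k A) ⟩
    - - det R _ A            ≈⟨ -‿involutive _ ⟩
    det R _ A                ∎
    where
    rest : Fin k → Row (suc (suc k))
    rest a = A (suc (suc a))
    C : Matrix R (suc (suc k))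
    C = B (suc zero) ∷ A zero ∷ rest
    swapB≈C : det R _ (swap₀₁ B) ≈ det R _ C
    swapB≈C = sumF-cong (suc (suc k)) {laplaceTerm (swap₀₁ B)} {laplaceTerm C} λ j → *-congˡ (*-congˡ
      (det-addMultiplesOfTop k (minor R C zero j) (minor R (swap₀₁ B) zero j) (λ a → g (suc a))
        (λ b → B₀≈A₀ _) (λ a b → B₊≈ (suc a) _)))
    C≈swapA : det R _ C ≈ det R _ (swap₀₁ A)
    C≈swapA = begin
      det R _ C
        ≈⟨ det-rowLinear _ C (swap₀₁ A) (A zero ∷ A zero ∷ rest) zero 1# (g zero) (sameTail _) (sameTail _)
             (λ b → trans (B₊≈ zero b) (+-congʳ (sym (*-identityˡ _)))) ⟩
      1# * det R _ (swap₀₁ A) + g zero * det R _ (A zero ∷ A zero ∷ rest)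
        ≈⟨ +-cong (*-identityˡ _) (*-congˡ (det-equalRows₀₁ k (A zero ∷ A zero ∷ rest) (λ _ → refl))) ⟩
      det R _ (swap₀₁ A) + g zero * 0#
        ≈⟨ trans (+-congˡ (zeroʳ _)) (+-identityʳ _) ⟩
      det R _ (swap₀₁ A) ∎

  det-lowerTriangular : ∀ k (L : Matrix R k) → (∀ a b → toℕ a ℕ.< toℕ b → L a b ≈ 0#) →
                        det R k L ≈ prodF R k (λ a → L a a)
  det-lowerTriangular zero    L _     = refl
  det-lowerTriangular (suc k) L upper≈0 = begin
    1# * (L zero zero * det R k (minor R L zero zero)) + sumF R k (λ l → laplaceTerm L (suc l))
      ≈⟨ +-cong (*-identityˡ _) (sumF-zero k λ l →
           trans (*-congˡ (*-congʳ (upper≈0 zero (suc l) (ℕ.s≤s ℕ.z≤n))))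
                 (trans (*-congˡ (zeroˡ _)) (zeroʳ _))) ⟩
    L zero zero * det R k (minor R L zero zero) + 0#
      ≈⟨ +-identityʳ _ ⟩
    L zero zero * det R k (minor R L zero zero)
      ≈⟨ *-congˡ (det-lowerTriangular k (minor R L zero zero)
           (λ a b a<b → upper≈0 (suc a) (suc b) (ℕ.s≤s a<b))) ⟩
    prodF R (suc k) (λ a → L a a) ∎

module Cofactors {c ℓ} (R : CommutativeRing c ℓ) where
  open CommutativeRing R hiding (zero)
  open import Relation.Binary.Reasoning.Setoid setoid
  open import Algebra.Properties.Ring ring using (-0#≈0#)
  open IntegerCoefficientSolver R using (solve; _:+_; _:*_; _:-_; :-_; con; _:=_)
  open SumsAndProducts R
  open Determinants R
  open Vector using (_∷_)

  ones : ∀ {k} → Row k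
  ones _ = 1#

  bordered : ∀ {k} → Matrix R (suc k) → Fin (suc k) → Matrix R (suc k)
  bordered A i = ones ∷ (λ a → A (punchIn i a))

  cof-bordered : ∀ k (A : Matrix R (suc k)) →
                 cof R k A ≈ sumF R (suc k) (λ i → sgn R (toℕ i) * det R (suc k) (bordered A i))
  cof-bordered k A = sumF-cong (suc k) λ i → begin
    sumF R (suc k) (λ j → sgn R (toℕ i ℕ.+ toℕ j) * det R k (minor R A i j))
      ≈⟨ sumF-cong (suc k) (λ j → trans (*-congʳ (sgn-+ (toℕ i) (toℕ j)))
           (solve 3 (λ s t d → (s :* t) :* d := s :* (t :* (con (+ 1) :* d))) refl
             (sgn R (toℕ i)) (sgn R (toℕ j)) (det R k (minor R A i j)))) ⟩
    sumF R (suc k) (λ j → sgn R (toℕ i) * laplaceTerm (bordered A i) j)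
      ≈⟨ *-distribˡ-sumF (suc k) (sgn R (toℕ i)) (laplaceTerm (bordered A i)) ⟨
    sgn R (toℕ i) * det R (suc k) (bordered A i) ∎

  cof-transpose : ∀ k (A : Matrix R (suc k)) → cof R k (A ᵀ) ≈ cof R k A
  cof-transpose k A = begin
    sumF R (suc k) (λ i → sumF R (suc k) (λ j → sgn R (toℕ i ℕ.+ toℕ j) * det R k (minor R A j i ᵀ)))
      ≈⟨ sumF-cong (suc k) (λ i → sumF-cong (suc k) (λ j →
           *-cong (reflexive (≡.cong (sgn R) (ℕ.+-comm (toℕ i) (toℕ j)))) (det-transpose k (minor R A j i)))) ⟩
    sumF R (suc k) (λ i → sumF R (suc k) (λ j → sgn R (toℕ j ℕ.+ toℕ i) * det R k (minor R A j i)))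
      ≈⟨ sumF-comm (suc k) (suc k) (λ i j → sgn R (toℕ j ℕ.+ toℕ i) * det R k (minor R A j i)) ⟩
    cof R k A ∎

  cof-addRowConstants : ∀ k (A B : Matrix R (suc k)) (f : Fin (suc k) → Carrier) →
                        (∀ a b → B a b ≈ A a b + f a) → cof R k B ≈ cof R k A
  cof-addRowConstants k A B f B≈ = begin
    cof R k B
      ≈⟨ cof-bordered k B ⟩
    sumF R (suc k) (λ i → sgn R (toℕ i) * det R (suc k) (bordered B i))
      ≈⟨ sumF-cong (suc k) (λ i → *-congˡ {sgn R (toℕ i)} (det-addMultiplesOfTop k (bordered A i) (bordered B i)
           (λ a → f (punchIn i a)) (λ _ → refl) (λ a b → trans (B≈ _ _) (+-congˡ (sym (*-identityʳ _)))))) ⟩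
    sumF R (suc k) (λ i → sgn R (toℕ i) * det R (suc k) (bordered A i))
      ≈⟨ cof-bordered k A ⟨
    cof R k A ∎

  cof-addColumnConstants : ∀ k (A B : Matrix R (suc k)) (g : Fin (suc k) → Carrier) →
                           (∀ a b → B a b ≈ A a b + g b) → cof R k B ≈ cof R k A
  cof-addColumnConstants k A B g B≈ = begin
    cof R k B       ≈⟨ cof-transpose k B ⟨
    cof R k (B ᵀ)   ≈⟨ cof-addRowConstants k (A ᵀ) (B ᵀ) g (λ a b → B≈ b a) ⟩
    cof R k (A ᵀ)   ≈⟨ cof-transpose k A ⟩
    cof R k A       ∎

  cof-zeroTopRow : ∀ k (A : Matrix R (suc k)) → (∀ b → A zero b ≈ 0#) →
                   cof R k A ≈ det R (suc k) (bordered A zero)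
  cof-zeroTopRow k A A₀≈0 = begin
    cof R k A
      ≈⟨ cof-bordered k A ⟩
    1# * det R (suc k) (bordered A zero) + others k A
      ≈⟨ +-cong (*-identityˡ _) (others≈0 k A A₀≈0) ⟩
    det R (suc k) (bordered A zero) + 0#
      ≈⟨ +-identityʳ _ ⟩
    det R (suc k) (bordered A zero) ∎
    where
    others : ∀ k → Matrix R (suc k) → Carrier
    others k A = sumF R k (λ i → sgn R (suc (toℕ i)) * det R (suc k) (bordered A (suc i)))
    others≈0 : ∀ k (A : Matrix R (suc k)) → (∀ b → A zero b ≈ 0#) → others k A ≈ 0#
    others≈0 zero    A _    = refl
    others≈0 (suc k) A A₀≈0 = sumF-zero (suc k) (λ i →
      trans (*-congˡ {sgn R (suc (toℕ i))} (det-zeroRow (suc (suc k)) (bordered A (suc i)) (suc zero) A₀≈0))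
            (zeroʳ _))

  -- Removing the row constants μ a − ψ a and the column constants ψ b leaves a
  -- matrix E with zero top row whose bordered matrix is triangular.
  cof-jumpsModuloPotential : ∀ k (D : Matrix R (suc k)) {p} (_⊑_ : Fin (suc k) → Fin (suc k) → Set p)
    (_⊑?_ : ∀ a b → Dec (a ⊑ b)) (jump ψ : Fin (suc k) → Carrier) →
    (∀ b → zero ⊑ b) → (∀ a → a ⊑ a) → (∀ {a b} → a ⊑ b → toℕ a ℕ.≤ toℕ b) →
    (∀ a b → D a b ≈ ((if does (a ⊑? b) then 0# else jump a) + ψ b) - ψ a) →
    cof R k D ≈ prodF R k (λ a → - jump (suc a))
  cof-jumpsModuloPotential k D _⊑_ _⊑?_ jump ψ zero⊑ ⊑-refl ⊑⇒≤ D≈ = begin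
    cof R k D
      ≈⟨ cof-addRowConstants k (λ a b → E a b + ψ b) D (λ a → μ a - ψ a)
           (λ a b → trans (D≈ a b) (split a b)) ⟩
    cof R k (λ a b → E a b + ψ b)
      ≈⟨ cof-addColumnConstants k E (λ a b → E a b + ψ b) ψ (λ _ _ → refl) ⟩
    cof R k E
      ≈⟨ cof-zeroTopRow k E E₀≈0 ⟩
    det R (suc k) (bordered E zero)
      ≈⟨ det-transpose (suc k) (bordered E zero) ⟨
    det R (suc k) (bordered E zero ᵀ)
      ≈⟨ det-lowerTriangular (suc k) (bordered E zero ᵀ) above≈0 ⟩
    1# * prodF R k (λ a → E (suc a) (suc a))
      ≈⟨ *-identityˡ _ ⟩
    prodF R k (λ a → E (suc a) (suc a))
      ≈⟨ prodF-cong k diagonal ⟩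
    prodF R k (λ a → - jump (suc a)) ∎
    where
    μ : Fin (suc k) → Carrier
    μ zero    = 0#
    μ (suc a) = jump (suc a)
    E : Matrix R (suc k)
    E a b = if does (a ⊑? b) then - μ a else 0#
    split : ∀ a b → ((if does (a ⊑? b) then 0# else jump a) + ψ b) - ψ a ≈ (E a b + ψ b) + (μ a - ψ a)
    split a b with a ⊑? b
    split a       b | yes _ = solve 3 (λ m p q → (con (+ 0) :+ q) :- p := ((:- m) :+ q) :+ (m :- p)) refl
                                (μ a) (ψ a) (ψ b)
    split zero    b | no 0⋢b = contradiction (zero⊑ b) 0⋢b
    split (suc a) b | no _   = solve 3 (λ j p q → (j :+ q) :- p := (con (+ 0) :+ q) :+ (j :- p)) refl
                                (jump (suc a)) (ψ (suc a)) (ψ b)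
    E₀≈0 : ∀ b → E zero b ≈ 0#
    E₀≈0 b with zero ⊑? b
    ... | yes _   = -0#≈0#
    ... | no 0⋢b = contradiction (zero⊑ b) 0⋢b
    above≈0 : ∀ a b → toℕ a ℕ.< toℕ b → bordered E zero b a ≈ 0#
    above≈0 a (suc b) a<b with suc b ⊑? a
    ... | yes b⊑a = contradiction (⊑⇒≤ b⊑a) (ℕ.<⇒≱ a<b)
    ... | no _    = refl
    diagonal : ∀ a → E (suc a) (suc a) ≈ - jump (suc a)
    diagonal a with suc a ⊑? suc a
    ... | yes _   = refl
    ... | no a⋢a = contradiction (⊑-refl (suc a)) a⋢a

cycleOffset : (r : ℕ) (m : Fin r → ℕ) → Fin r → ℕ
cycleOffset (suc r) m zero    = 0
cycleOffset (suc r) m (suc j) = m zero ℕ.+ cycleOffset r (λ j → m (suc j)) j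

toℕ-splitAt-inj₁ : ∀ a {b} {k : Fin (a ℕ.+ b)} {i} → Fin.splitAt a k ≡ inj₁ i → toℕ k ≡ toℕ i
toℕ-splitAt-inj₁ a {b} {i = i} eq = ≡.trans (≡.cong toℕ (≡.sym (Fin.splitAt⁻¹-↑ˡ eq))) (Fin.toℕ-↑ˡ i b)

toℕ-splitAt-inj₂ : ∀ a {b} {k : Fin (a ℕ.+ b)} {i} → Fin.splitAt a k ≡ inj₂ i → toℕ k ≡ a ℕ.+ toℕ i
toℕ-splitAt-inj₂ a {i = i} eq = ≡.trans (≡.cong toℕ (≡.sym (Fin.splitAt⁻¹-↑ʳ eq))) (Fin.toℕ-↑ʳ a i)

vblock-offset : ∀ r (m : Fin r → ℕ) k →
  cycleOffset r m (proj₁ (vblock r m k)) ℕ.+ toℕ (proj₂ (vblock r m k)) ≡ toℕ k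
vblock-offset (suc r) m k with Fin.splitAt (m zero) k in eq
... | inj₁ i = ≡.sym (toℕ-splitAt-inj₁ (m zero) eq)
... | inj₂ k′ with vblock r (λ j → m (suc j)) k′ | vblock-offset r (λ j → m (suc j)) k′
...   | j , i | offset+i≡k′ = ≡.trans (ℕ.+-assoc (m zero) _ _)
          (≡.trans (≡.cong (m zero ℕ.+_) offset+i≡k′) (≡.sym (toℕ-splitAt-inj₂ (m zero) eq)))

module DCDigraph {n r : ℕ} {m : Fin r → ℕ} where
  open import Data.Product using (_×_)
  open Defs using (Vtx; u; v; Edge; eU; eFirst; eMid; eLast; Path; []; _∷_; vertices; IsSimple)

  V : Set
  V = Vtx n r m

  top : V
  top = u (fromℕ n)

  -- y can be reached from x without a closing edge v_{m_j}^(j) → u_0.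
  data Forward : V → V → Set where
    u≤u : ∀ {a b} → toℕ a ℕ.≤ toℕ b → Forward (u a) (u b)
    u→v : ∀ {a j k} → Forward (u a) (v j k)
    v≤v : ∀ {j a b} → toℕ a ℕ.≤ toℕ b → Forward (v j a) (v j b)

  forward? : ∀ x y → Dec (Forward x y)
  forward? (u a) (u b) with toℕ a ℕ.≤? toℕ b
  ... | yes a≤b = yes (u≤u a≤b)
  ... | no  a≰b = no λ { (u≤u a≤b) → a≰b a≤b }
  forward? (u a)   (v j k) = yes u→v
  forward? (v j k) (u b)   = no λ ()
  forward? (v j a) (v j′ b) with j Fin.≟ j′
  ... | no j≢j′ = no λ { (v≤v _) → j≢j′ ≡.refl }
  ... | yes ≡.refl with toℕ a ℕ.≤? toℕ b
  ...   | yes a≤b = yes (v≤v a≤b)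
  ...   | no  a≰b = no λ { (v≤v a≤b) → a≰b a≤b }

  forward-refl : ∀ x → Forward x x
  forward-refl (u a)   = u≤u ℕ.≤-refl
  forward-refl (v j a) = v≤v ℕ.≤-refl

  forward-from-u₀ : ∀ y → Forward (u zero) y
  forward-from-u₀ (u b)   = u≤u ℕ.z≤n
  forward-from-u₀ (v j k) = u→v

  private
    successor : ∀ {k} {i : Fin k} {b} → toℕ i ℕ.≤ toℕ b → b ≢ i → suc (toℕ i) ℕ.≤ toℕ b
    successor i≤b b≢i = ℕ.≤∧≢⇒< i≤b (λ i≡b → b≢i (≡.sym (Fin.toℕ-injective i≡b)))

  forward-along-eU : ∀ {i : Fin n} {y} → Forward (u (inject₁ i)) y → y ≢ u (inject₁ i) →
                     Forward (u (suc i)) y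
  forward-along-eU {i} (u≤u i≤b) y≢i =
    u≤u (≡.subst (λ t → suc t ℕ.≤ _) (Fin.toℕ-inject₁ i) (successor i≤b (y≢i ∘ ≡.cong u)))
  forward-along-eU u→v _ = u→v

  forward-back-eU : ∀ {i : Fin n} {y} → Forward (u (suc i)) y → Forward (u (inject₁ i)) y
  forward-back-eU {i} (u≤u 1+i≤b) =
    u≤u (ℕ.≤-trans (ℕ.≤-reflexive (Fin.toℕ-inject₁ i)) (ℕ.≤-trans (ℕ.n≤1+n _) 1+i≤b))
  forward-back-eU u→v = u→v

  forward-back-eFirst : ∀ {j k y} → Forward (v j k) y → Forward top y
  forward-back-eFirst (v≤v _) = u→v

  forward-along-eMid : ∀ {j} {i k : Fin (m j)} {y} → toℕ k ≡ suc (toℕ i) →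
                       Forward (v j i) y → y ≢ v j i → Forward (v j k) y
  forward-along-eMid k≡1+i (v≤v i≤b) y≢i =
    v≤v (≡.subst (ℕ._≤ _) (≡.sym k≡1+i) (successor i≤b (y≢i ∘ ≡.cong (v _))))

  forward-back-eMid : ∀ {j} {i k : Fin (m j)} {y} → toℕ k ≡ suc (toℕ i) →
                      Forward (v j k) y → Forward (v j i) y
  forward-back-eMid k≡1+i (v≤v k≤b) = v≤v (ℕ.≤-trans (ℕ.n≤1+n _) (≡.subst (ℕ._≤ _) k≡1+i k≤b))

  forward-from-last : ∀ {j} {i : Fin (m j)} {y} → suc (toℕ i) ≡ m j → Forward (v j i) y → y ≡ v j i
  forward-from-last {j} {i} last (v≤v {b = b} i≤b) =
    ≡.cong (v j) (Fin.toℕ-injective (ℕ.≤-antisym b≤i i≤b))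
    where
    b≤i : toℕ b ℕ.≤ toℕ i
    b≤i = ℕ.≤-pred (≡.subst (toℕ b ℕ.<_) (≡.sym last) (Fin.toℕ<n b))

  forward-from-top : ∀ {b} → Forward top (u b) → u b ≡ top
  forward-from-top {b} (u≤u n≤b) = ≡.cong u (Fin.toℕ-injective (≡.trans
    (ℕ.≤-antisym (Fin.toℕ≤pred[n] b) (≡.subst (ℕ._≤ toℕ b) (Fin.toℕ-fromℕ n) n≤b))
    (≡.sym (Fin.toℕ-fromℕ n))))

  IsU : V → Set
  IsU (u _)   = ⊤
  IsU (v _ _) = ⊥

  -- The only edge into a cycle leaves from top.
  top∈path-into-cycle : ∀ {x j k} (p : Path x (v j k)) → IsU x ⊎ ¬ Forward x (v j k) → top ∈ vertices p
  top∈path-into-cycle []                   (inj₁ ())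
  top∈path-into-cycle []                   (inj₂ ¬f) = ⊥-elim (¬f (forward-refl _))
  top∈path-into-cycle (eU i ∷ p)           _         = there (top∈path-into-cycle p (inj₁ tt))
  top∈path-into-cycle (eFirst j k _ ∷ p)   _         = here ≡.refl
  top∈path-into-cycle (eMid j i k _ ∷ p)   (inj₁ ())
  top∈path-into-cycle (eMid j i k k≡ ∷ p)  (inj₂ ¬f) =
    there (top∈path-into-cycle p (inj₂ (¬f ∘ forward-back-eMid k≡)))
  top∈path-into-cycle (eLast j i _ ∷ p)    _         = there (top∈path-into-cycle p (inj₁ tt))

  forward-after-eFirst : ∀ {j k y} (p : Path (v j k) y) → All (top ≢_) (vertices p) →
                         Forward top y → y ≢ top → Forward (v j k) y
  forward-after-eFirst {y = u b}    p top∉p f y≢top = ⊥-elim (y≢top (forward-from-top f))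
  forward-after-eFirst {j} {k} {v j′ k′} p top∉p f y≢top with forward? (v j k) (v j′ k′)
  ... | yes f′ = f′
  ... | no ¬f′ = ⊥-elim (All.lookup top∉p (top∈path-into-cycle p (inj₂ ¬f′)) ≡.refl)

  last∈vertices : ∀ {x y : V} (p : Path x y) → y ∈ vertices p
  last∈vertices []      = here ≡.refl
  last∈vertices (e ∷ p) = there (last∈vertices p)

  infixr 5 _++ₚ_
  _++ₚ_ : ∀ {x y z : V} → Path x y → Path y z → Path x z
  []      ++ₚ q = q
  (e ∷ p) ++ₚ q = e ∷ (p ++ₚ q)

  module _ (rank : V → ℕ) where
    Ascending : ∀ {x y : V} → Path x y → Set
    Ascending []                  = ⊤
    Ascending (_∷_ {x} {y} e p) = rank x ℕ.< rank y × Ascending p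

    ascending-bound : ∀ {x y : V} (p : Path x y) → Ascending p →
                      All (λ z → rank x ℕ.≤ rank z) (vertices p)
    ascending-bound []      _          = ℕ.≤-refl All.∷ All.[]
    ascending-bound (e ∷ p) (x<y , p↑) =
      ℕ.≤-refl All.∷ All.map (ℕ.≤-trans (ℕ.<⇒≤ x<y)) (ascending-bound p p↑)

    ascending⇒simple : ∀ {x y : V} (p : Path x y) → Ascending p → IsSimple p
    ascending⇒simple []      _          = All.[] AllPairs.∷ AllPairs.[]
    ascending⇒simple (e ∷ p) (x<y , p↑) =
      All.map (λ y≤z x≡z → ℕ.<-irrefl ≡.refl
                 (ℕ.<-≤-trans x<y (≡.subst (λ z → _ ℕ.≤ rank z) (≡.sym x≡z) y≤z)))
              (ascending-bound p p↑)
      AllPairs.∷ ascending⇒simple p p↑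

    ascending-++ : ∀ {x y z : V} (p : Path x y) (q : Path y z) → Ascending p → Ascending q → Ascending (p ++ₚ q)
    ascending-++ []      q _          q↑ = q↑
    ascending-++ (e ∷ p) q (x<y , p↑) q↑ = x<y , ascending-++ p q p↑ q↑

  data Injected : Fin (suc n) → Set where
    injected : (i : Fin n) → Injected (inject₁ i)

  injected? : ∀ a → toℕ a ℕ.< n → Injected a
  injected? a a<n = ≡.subst Injected (Fin.inject₁-lower₁ a n≢a) (injected (Fin.lower₁ a n≢a))
    where
    n≢a : n ≢ toℕ a
    n≢a = ℕ.<⇒≢ a<n ∘ ≡.sym

  climb-below : ∀ d (a b : Fin (suc n)) → toℕ a ℕ.+ suc d ≡ toℕ b → toℕ a ℕ.< n
  climb-below d a b a+d≡b =
    ℕ.<-≤-trans (ℕ.m<m+n (toℕ a) (ℕ.s≤s ℕ.z≤n))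
                (≡.subst (ℕ._≤ n) (≡.sym a+d≡b) (Fin.toℕ≤pred[n] b))

  climb-next : ∀ d (i : Fin n) (b : Fin (suc n)) →
               toℕ (inject₁ i) ℕ.+ suc d ≡ toℕ b → toℕ (suc i) ℕ.+ d ≡ toℕ b
  climb-next d i b i+d≡b = ≡.trans (≡.cong (λ t → suc t ℕ.+ d) (≡.sym (Fin.toℕ-inject₁ i)))
                                   (≡.trans (≡.sym (ℕ.+-suc _ d)) i+d≡b)

  climb-end : ∀ (a b : Fin (suc n)) → toℕ a ℕ.+ 0 ≡ toℕ b → a ≡ b
  climb-end a b a+0≡b = Fin.toℕ-injective (≡.trans (≡.sym (ℕ.+-identityʳ (toℕ a))) a+0≡b)

  climb : ∀ d (a b : Fin (suc n)) → toℕ a ℕ.+ d ≡ toℕ b → Path {n} {r} {m} (u a) (u b)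
  climb zero    a b a+0≡b with climb-end a b a+0≡b
  ... | ≡.refl = []
  climb (suc d) a b a+d≡b with injected? a (climb-below d a b a+d≡b)
  ... | injected i = eU i ∷ climb d (suc i) b (climb-next d i b a+d≡b)

  climb-ascending : ∀ (rank : V → ℕ) d (a b : Fin (suc n)) a+d≡b →
    (∀ (i : Fin n) → toℕ a ℕ.≤ toℕ i → toℕ i ℕ.< toℕ b →
       rank (u (inject₁ i)) ℕ.< rank (u (suc i))) →
    Ascending rank (climb d a b a+d≡b)
  climb-ascending rank zero    a b a+0≡b _ with climb-end a b a+0≡b
  ... | ≡.refl = tt
  climb-ascending rank (suc d) a b a+d≡b step↑ with injected? a (climb-below d a b a+d≡b)
  ... | injected i =
    step↑ i (ℕ.≤-reflexive (Fin.toℕ-inject₁ i)) i<b ,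
    climb-ascending rank d (suc i) b (climb-next d i b a+d≡b)
      (λ i′ 1+i≤i′ → step↑ i′ (ℕ.≤-trans (ℕ.≤-reflexive (Fin.toℕ-inject₁ i)) (ℕ.<⇒≤ 1+i≤i′)))
    where
    i<b : toℕ i ℕ.< toℕ b
    i<b = ≡.subst (toℕ i ℕ.<_) (climb-next d i b a+d≡b) (ℕ.m≤m+n (suc (toℕ i)) d)

  cycle-below : ∀ {j} d (k : Fin (m j)) → suc (toℕ k) ℕ.+ suc d ≡ m j → suc (toℕ k) ℕ.< m j
  cycle-below d k k+d≡m =
    ≡.subst (suc (suc (toℕ k)) ℕ.≤_) (≡.trans (≡.sym (ℕ.+-suc (suc (toℕ k)) d)) k+d≡m) (ℕ.m≤m+n _ d)

  cycle-next : ∀ {j} d (k : Fin (m j)) (k+d≡m : suc (toℕ k) ℕ.+ suc d ≡ m j) →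
               suc (toℕ (fromℕ< (cycle-below d k k+d≡m))) ℕ.+ d ≡ m j
  cycle-next d k k+d≡m = ≡.trans (≡.cong (λ t → suc t ℕ.+ d) (Fin.toℕ-fromℕ< (cycle-below d k k+d≡m)))
                                 (≡.trans (≡.sym (ℕ.+-suc (suc (toℕ k)) d)) k+d≡m)

  finishCycle : ∀ j d (k : Fin (m j)) → suc (toℕ k) ℕ.+ d ≡ m j → Path {n} {r} {m} (v j k) (u zero)
  finishCycle j zero    k k+0≡m = eLast j k (≡.trans (≡.sym (ℕ.+-identityʳ _)) k+0≡m) ∷ []
  finishCycle j (suc d) k k+d≡m =
    eMid j k (fromℕ< (cycle-below d k k+d≡m)) (Fin.toℕ-fromℕ< (cycle-below d k k+d≡m))
    ∷ finishCycle j d (fromℕ< (cycle-below d k k+d≡m)) (cycle-next d k k+d≡m)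

  _≟ᵥ_ : (x y : V) → Dec (x ≡ y)
  u a   ≟ᵥ u b with a Fin.≟ b
  ... | yes ≡.refl = yes ≡.refl
  ... | no  a≢b    = no λ { ≡.refl → a≢b ≡.refl }
  u _   ≟ᵥ v _ _ = no λ ()
  v _ _ ≟ᵥ u _   = no λ ()
  v j a ≟ᵥ v j′ b with j Fin.≟ j′
  ... | no  j≢j′   = no λ { ≡.refl → j≢j′ ≡.refl }
  ... | yes ≡.refl with a Fin.≟ b
  ...   | yes ≡.refl = yes ≡.refl
  ...   | no  a≢b    = no λ { ≡.refl → a≢b ≡.refl }

  position : V → ℕ
  position (u i)   = toℕ i
  position (v j k) = suc n ℕ.+ (cycleOffset r m j ℕ.+ toℕ k)

  position-enum : ∀ k → position (enum n r m k) ≡ toℕ k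
  position-enum k with Fin.splitAt (suc n) k in eq
  ... | inj₁ i = ≡.sym (toℕ-splitAt-inj₁ (suc n) eq)
  ... | inj₂ k′ with vblock r m k′ | vblock-offset r m k′
  ...   | j , i | offset+i≡k′ =
    ≡.trans (≡.cong (suc n ℕ.+_) offset+i≡k′) (≡.sym (toℕ-splitAt-inj₂ (suc n) eq))

  position-mono : ∀ {x y} → Forward x y → position x ℕ.≤ position y
  position-mono (u≤u a≤b)      = a≤b
  position-mono {u a}   u→v       =
    ℕ.≤-trans (Fin.toℕ≤pred[n] a) (ℕ.≤-trans (ℕ.n≤1+n n) (ℕ.m≤m+n (suc n) _))
  position-mono {v j _} (v≤v a≤b) = ℕ.+-monoʳ-≤ (suc n) (ℕ.+-monoʳ-≤ (cycleOffset r m j) a≤b)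

  enum-↑ˡ : ∀ i → enum n r m (i Fin.↑ˡ total r m) ≡ u i
  enum-↑ˡ i with Fin.splitAt (suc n) (i Fin.↑ˡ total r m) | Fin.splitAt-↑ˡ (suc n) i (total r m)
  ... | _ | ≡.refl = ≡.refl

  enum-↑ʳ : ∀ k → enum n r m (suc n Fin.↑ʳ k) ≡ v (proj₁ (vblock r m k)) (proj₂ (vblock r m k))
  enum-↑ʳ k with Fin.splitAt (suc n) (suc n Fin.↑ʳ k) | Fin.splitAt-↑ʳ (suc n) (total r m) k
  ... | _ | ≡.refl with vblock r m k
  ...   | j , i = ≡.refl

  module BackwardRoute (j : Fin r) (1≤m : 1 ℕ.≤ m j) (a b : Fin (suc n)) (b<a : toℕ b ℕ.< toℕ a) where
    -- Position along the route u_a → … → u_n → cycle j → u_0 → … → u_b.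
    rank : V → ℕ
    rank (u i) with toℕ i ℕ.<? toℕ a
    ... | yes _ = suc n ℕ.+ m j ℕ.+ toℕ i
    ... | no  _ = toℕ i
    rank (v _ k) = suc n ℕ.+ toℕ k

    rank-eU : ∀ (i : Fin n) → suc (toℕ i) ≢ toℕ a → rank (u (inject₁ i)) ℕ.< rank (u (suc i))
    rank-eU i 1+i≢a with toℕ (inject₁ i) ℕ.<? toℕ a | suc (toℕ i) ℕ.<? toℕ a
    ... | yes _   | yes _    = ℕ.+-monoʳ-< (suc n ℕ.+ m j) (ℕ.s≤s (ℕ.≤-reflexive (Fin.toℕ-inject₁ i)))
    ... | no  _   | no  _    = ℕ.s≤s (ℕ.≤-reflexive (Fin.toℕ-inject₁ i))
    ... | yes i<a | no  1+i≮a =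
      contradiction (ℕ.≤∧≢⇒< (≡.subst (ℕ._< toℕ a) (Fin.toℕ-inject₁ i) i<a) 1+i≢a) 1+i≮a
    ... | no  i≮a | yes 1+i<a =
      contradiction (≡.subst (ℕ._< toℕ a) (≡.sym (Fin.toℕ-inject₁ i)) (ℕ.<-trans (ℕ.n<1+n _) 1+i<a)) i≮a

    rank-top : rank top ≡ n
    rank-top with toℕ (fromℕ n) ℕ.<? toℕ a
    ... | yes n<a =
      contradiction (≡.subst (ℕ._< toℕ a) (Fin.toℕ-fromℕ n) n<a) (ℕ.≤⇒≯ (Fin.toℕ≤pred[n] a))
    ... | no  _   = Fin.toℕ-fromℕ n

    rank-u₀ : rank (u zero) ≡ suc n ℕ.+ m j ℕ.+ 0
    rank-u₀ with 0 ℕ.<? toℕ a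
    ... | yes _   = ≡.refl
    ... | no  0≮a = contradiction (ℕ.≤-<-trans ℕ.z≤n b<a) 0≮a

    finishCycle-ascending : ∀ d (k : Fin (m j)) k+d≡m → Ascending rank (finishCycle j d k k+d≡m)
    finishCycle-ascending zero    k _ =
      ≡.subst (suc n ℕ.+ toℕ k ℕ.<_) (≡.sym rank-u₀)
        (ℕ.≤-trans (ℕ.+-monoʳ-< (suc n) (Fin.toℕ<n k)) (ℕ.m≤m+n _ 0)) , tt
    finishCycle-ascending (suc d) k k+d≡m =
      ℕ.+-monoʳ-< (suc n) (ℕ.≤-reflexive (≡.sym (Fin.toℕ-fromℕ< (cycle-below d k k+d≡m)))) ,
      finishCycle-ascending d (fromℕ< (cycle-below d k k+d≡m)) (cycle-next d k k+d≡m)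

    k₀ : Fin (m j)
    k₀ = fromℕ< 1≤m

    a+rest≡n : toℕ a ℕ.+ (n ℕ.∸ toℕ a) ≡ toℕ (fromℕ n)
    a+rest≡n = ≡.trans (ℕ.m+[n∸m]≡n (Fin.toℕ≤pred[n] a)) (≡.sym (Fin.toℕ-fromℕ n))

    k₀+rest≡m : suc (toℕ k₀) ℕ.+ (m j ℕ.∸ 1) ≡ m j
    k₀+rest≡m =
      ≡.trans (≡.cong (λ t → suc t ℕ.+ (m j ℕ.∸ 1)) (Fin.toℕ-fromℕ< 1≤m)) (ℕ.m+[n∸m]≡n 1≤m)

    up : Path (u a) top
    up = climb (n ℕ.∸ toℕ a) a (fromℕ n) a+rest≡n

    around : Path top (u zero)
    around = eFirst j k₀ (Fin.toℕ-fromℕ< 1≤m) ∷ finishCycle j (m j ℕ.∸ 1) k₀ k₀+rest≡m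

    down : Path (u zero) (u b)
    down = climb (toℕ b) zero b ≡.refl

    route : Path (u a) (u b)
    route = up ++ₚ around ++ₚ down

    route-simple : IsSimple route
    route-simple = ascending⇒simple rank route
      (ascending-++ rank up (around ++ₚ down)
        (climb-ascending rank (n ℕ.∸ toℕ a) a (fromℕ n) a+rest≡n λ i a≤i _ →
          rank-eU i λ 1+i≡a → ℕ.<-irrefl (≡.sym 1+i≡a) (ℕ.s≤s a≤i))
        (ascending-++ rank around down
          (≡.subst (ℕ._< suc n ℕ.+ toℕ k₀) (≡.sym rank-top) (ℕ.m≤m+n (suc n) _) ,
           finishCycle-ascending (m j ℕ.∸ 1) k₀ k₀+rest≡m)
          (climb-ascending rank (toℕ b) zero b ≡.refl λ i _ i<b →
            rank-eU i λ 1+i≡a → ℕ.<-irrefl 1+i≡a (ℕ.≤-<-trans i<b b<a))))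

module EnumerationProducts {c ℓ} (R : CommutativeRing c ℓ) where
  open CommutativeRing R hiding (zero)
  open import Relation.Binary.Reasoning.Setoid setoid
  open SumsAndProducts R
  open Defs using (Vtx; u; v)

  prodF-vblock : ∀ r (m : Fin r → ℕ) (h : Fin r → Carrier) →
                 prodF R (total r m) (λ k → h (proj₁ (vblock r m k))) ≈ prodF R r (λ j → pow R (h j) (m j))
  prodF-vblock zero    m h = refl
  prodF-vblock (suc r) m h = begin
    prodF R (m zero ℕ.+ T) (λ k → h (proj₁ (vblock (suc r) m k)))
      ≈⟨ prodF-++ (m zero) T _ ⟩
    prodF R (m zero) (λ i → h (proj₁ (vblock (suc r) m (i Fin.↑ˡ T)))) *
    prodF R T (λ k → h (proj₁ (vblock (suc r) m (m zero Fin.↑ʳ k))))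
      ≈⟨ *-cong (prodF-cong (m zero) (λ i → reflexive (≡.cong h (first-block i))))
                (prodF-cong T (λ k → reflexive (≡.cong h (later-blocks k)))) ⟩
    prodF R (m zero) (λ _ → h zero) * prodF R T (λ k → h (suc (proj₁ (vblock r (λ j → m (suc j)) k))))
      ≈⟨ *-cong (prodF-const (m zero) (h zero)) (prodF-vblock r (λ j → m (suc j)) (λ j → h (suc j))) ⟩
    prodF R (suc r) (λ j → pow R (h j) (m j)) ∎
    where
    T : ℕ
    T = total r (λ j → m (suc j))
    first-block : ∀ i → proj₁ (vblock (suc r) m (i Fin.↑ˡ T)) ≡ zero
    first-block i with Fin.splitAt (m zero) (i Fin.↑ˡ T) | Fin.splitAt-↑ˡ (m zero) i T
    ... | _ | ≡.refl = ≡.refl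
    later-blocks : ∀ k →
      proj₁ (vblock (suc r) m (m zero Fin.↑ʳ k)) ≡ suc (proj₁ (vblock r (λ j → m (suc j)) k))
    later-blocks k with Fin.splitAt (m zero) (m zero Fin.↑ʳ k) | Fin.splitAt-↑ʳ (m zero) T k
    ... | _ | ≡.refl with vblock r (λ j → m (suc j)) k
    ...   | j , i = ≡.refl

  prodF-enum : ∀ {n r m} (f : Vtx n r m → Carrier) →
    prodF R (n ℕ.+ total r m) (λ a → f (enum n r m (suc a)))
      ≈ prodF R n (λ i → f (u (suc i)))
        * prodF R (total r m) (λ k → f (v (proj₁ (vblock r m k)) (proj₂ (vblock r m k))))
  prodF-enum {n} {r} {m} f = trans (prodF-++ n (total r m) _)
    (*-cong (prodF-cong n (λ i → reflexive (≡.cong f (DCDigraph.enum-↑ˡ (suc i)))))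
            (prodF-cong (total r m) (λ k → reflexive (≡.cong f (DCDigraph.enum-↑ʳ k)))))

module WeightedDC {c ℓ} (R : CommutativeRing c ℓ) {n r : ℕ} {m : Fin r → ℕ}
                  (W : Fin n → CommutativeRing.Carrier R)
                  (Wv : (j : Fin r) → Fin (suc (m j)) → CommutativeRing.Carrier R) where
  open CommutativeRing R hiding (zero)
  open import Relation.Binary.Reasoning.Setoid setoid
  open IntegerCoefficientSolver R using (solve; _:+_; _:-_; con; _:=_)
  open Defs using (Vtx; u; v; Edge; eU; eFirst; eMid; eLast; Path; []; _∷_; vertices; IsSimple)
  open Defs.Weighted R W Wv
  open SumsAndProducts R using (prodF-const; pow-neg; prodF-cong; prodF-sgn; sgn-+)
  open EnumerationProducts R
  open import Algebra.Properties.CommutativeSemigroup *-commutativeSemigroup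
    using () renaming (interchange to *-interchange)

  open DCDigraph {n} {r} {m}

  partialSum : (k : ℕ) → (Fin k → Carrier) → ℕ → Carrier
  partialSum k       f zero    = 0#
  partialSum zero    f (suc t) = 0#
  partialSum (suc k) f (suc t) = f zero + partialSum k (λ i → f (suc i)) t

  partialSum-step : ∀ k f (i : Fin k) → partialSum k f (suc (toℕ i)) ≈ partialSum k f (toℕ i) + f i
  partialSum-step (suc k) f zero    = +-comm _ _
  partialSum-step (suc k) f (suc i) = trans (+-congˡ (partialSum-step k (λ i → f (suc i)) i)) (sym (+-assoc _ _ _))

  partialSum-all : ∀ k f → partialSum k f k ≈ sumF R k f
  partialSum-all zero    f = refl
  partialSum-all (suc k) f = +-congˡ (partialSum-all k (λ i → f (suc i)))

  cycleWeights : (j : Fin r) → Fin (m j) → Carrier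
  cycleWeights j i = Wv j (suc i)

  potential : V → Carrier
  potential (u i)   = partialSum n W (toℕ i)
  potential (v j k) = wc + partialSum (m j) (cycleWeights j) (suc (toℕ k))

  closingWeight : ∀ {x y : V} → Edge x y → Carrier
  closingWeight (eLast j _ _) = w j
  closingWeight _             = 0#

  winding : ∀ {x y : V} → Path x y → Carrier
  winding []      = 0#
  winding (e ∷ p) = closingWeight e + winding p

  edgeWeight-potential : ∀ {x y : V} (e : Edge x y) → edgeWeight e ≈ (potential y - potential x) + closingWeight e
  edgeWeight-potential (eU i) = begin
    W i
      ≈⟨ solve 2 (λ s t → t := ((s :+ t) :- s) :+ con (+ 0)) refl (partialSum n W (toℕ i)) (W i) ⟩
    ((partialSum n W (toℕ i) + W i) - partialSum n W (toℕ i)) + 0#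
      ≈⟨ +-congʳ (+-cong (partialSum-step n W i)
                         (-‿cong (reflexive (≡.cong (partialSum n W) (Fin.toℕ-inject₁ i))))) ⟨
    (partialSum n W (suc (toℕ i)) - partialSum n W (toℕ (inject₁ i))) + 0# ∎
  edgeWeight-potential (eFirst j k k≡0) = begin
    Wv j (suc k)
      ≈⟨ solve 2 (λ a t → t := ((a :+ (con (+ 0) :+ t)) :- a) :+ con (+ 0)) refl wc (Wv j (suc k)) ⟩
    ((wc + (0# + cycleWeights j k)) - wc) + 0#
      ≈⟨ +-congʳ (+-cong (+-congˡ first) (-‿cong last)) ⟨
    ((wc + partialSum (m j) (cycleWeights j) (suc (toℕ k))) - partialSum n W (toℕ (fromℕ n))) + 0# ∎
    where
    first : partialSum (m j) (cycleWeights j) (suc (toℕ k)) ≈ 0# + cycleWeights j k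
    first = trans (partialSum-step (m j) (cycleWeights j) k)
                  (+-congʳ (reflexive (≡.cong (partialSum (m j) (cycleWeights j)) k≡0)))
    last : partialSum n W (toℕ (fromℕ n)) ≈ wc
    last = trans (reflexive (≡.cong (partialSum n W) (Fin.toℕ-fromℕ n))) (partialSum-all n W)
  edgeWeight-potential (eMid j i k k≡1+i) = begin
    Wv j (suc k)
      ≈⟨ solve 3 (λ a s t → t := ((a :+ (s :+ t)) :- (a :+ s)) :+ con (+ 0)) refl wc before (Wv j (suc k)) ⟩
    ((wc + (before + cycleWeights j k)) - (wc + before)) + 0#
      ≈⟨ +-congʳ (+-congʳ (+-congˡ step)) ⟨
    ((wc + partialSum (m j) (cycleWeights j) (suc (toℕ k))) - (wc + before)) + 0# ∎
    where
    before = partialSum (m j) (cycleWeights j) (suc (toℕ i))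
    step : partialSum (m j) (cycleWeights j) (suc (toℕ k)) ≈ before + cycleWeights j k
    step = trans (partialSum-step (m j) (cycleWeights j) k)
                 (+-congʳ (reflexive (≡.cong (partialSum (m j) (cycleWeights j)) k≡1+i)))
  edgeWeight-potential (eLast j i last) = begin
    Wv j zero
      ≈⟨ solve 3 (λ a s t → t := (con (+ 0) :- (a :+ s)) :+ (a :+ (t :+ s))) refl
           wc (sumF R (m j) (cycleWeights j)) (Wv j zero) ⟩
    (0# - (wc + sumF R (m j) (cycleWeights j))) + w j
      ≈⟨ +-congʳ (+-congˡ (-‿cong (+-congˡ whole))) ⟨
    (0# - (wc + partialSum (m j) (cycleWeights j) (suc (toℕ i)))) + w j ∎
    where
    whole : partialSum (m j) (cycleWeights j) (suc (toℕ i)) ≈ sumF R (m j) (cycleWeights j)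
    whole = trans (reflexive (≡.cong (partialSum (m j) (cycleWeights j)) last))
                  (partialSum-all (m j) (cycleWeights j))

  pathWeight-potential : ∀ {x y : V} (p : Path x y) → pathWeight p ≈ (potential y - potential x) + winding p
  pathWeight-potential {x} [] = solve 1 (λ a → con (+ 0) := (a :- a) :+ con (+ 0)) refl (potential x)
  pathWeight-potential {x} {z} (_∷_ {y = y} e p) = begin
    edgeWeight e + pathWeight p
      ≈⟨ +-cong (edgeWeight-potential e) (pathWeight-potential p) ⟩
    ((potential y - potential x) + closingWeight e) + ((potential z - potential y) + winding p)
      ≈⟨ solve 5 (λ a b c d f → ((b :- a) :+ d) :+ ((c :- b) :+ f) := (c :- a) :+ (d :+ f)) refl
           (potential x) (potential y) (potential z) (closingWeight e) (winding p) ⟩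
    (potential z - potential x) + (closingWeight e + winding p) ∎

  Jump : V → Carrier → Set ℓ
  Jump (u _)   t = Σ (Fin r) λ j → t ≈ w j
  Jump (v j _) t = t ≈ w j

  record SimpleWinding {x y : V} (p : Path x y) : Set (c ⊔ ℓ) where
    field
      when-forward  : Forward x y → winding p ≈ 0#
      when-backward : ¬ Forward x y → Jump x (winding p)

  -- A simple path passes u_0 at most once, hence uses at most one closing edge.
  simpleWinding : ∀ {x y : V} (p : Path x y) → IsSimple p → SimpleWinding p
  simpleWinding {x} [] _ = record
    { when-forward  = λ _ → refl
    ; when-backward = λ ¬f → ⊥-elim (¬f (forward-refl x)) }
  simpleWinding {x} {y} (e ∷ p) (x∉p AllPairs.∷ p-simple) = along e
    where
    open SimpleWinding (simpleWinding p p-simple)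
    y≢x : y ≢ x
    y≢x y≡x = All.lookup x∉p (last∈vertices p) (≡.sym y≡x)
    along : (e : Edge x _) → SimpleWinding (e ∷ p)
    along (eU i) = record
      { when-forward  = λ f → trans (+-identityˡ _) (when-forward (forward-along-eU f y≢x))
      ; when-backward = λ ¬f → let j , t≈w = when-backward (¬f ∘ forward-back-eU)
                               in  j , trans (+-identityˡ _) t≈w }
    along (eFirst j k _) = record
      { when-forward  = λ f → trans (+-identityˡ _) (when-forward (forward-after-eFirst p x∉p f y≢x))
      ; when-backward = λ ¬f → j , trans (+-identityˡ _) (when-backward (¬f ∘ forward-back-eFirst)) }
    along (eMid j i k k≡1+i) = record
      { when-forward  = λ f → trans (+-identityˡ _) (when-forward (forward-along-eMid k≡1+i f y≢x))
      ; when-backward = λ ¬f → trans (+-identityˡ _) (when-backward (¬f ∘ forward-back-eMid k≡1+i)) }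
    along (eLast j i last) = record
      { when-forward  = λ f → ⊥-elim (y≢x (forward-from-last last f))
      ; when-backward = λ _ → trans (+-congˡ (when-forward (forward-from-u₀ y))) (+-identityʳ _) }

  winding-++ : ∀ {x y z : V} (p : Path x y) (q : Path y z) → winding (p ++ₚ q) ≈ winding p + winding q
  winding-++ []      q = sym (+-identityˡ _)
  winding-++ (e ∷ p) q = trans (+-congˡ (winding-++ p q)) (sym (+-assoc _ _ _))

  winding-climb : ∀ d (a b : Fin (suc n)) a+d≡b → winding (climb d a b a+d≡b) ≈ 0#
  winding-climb zero    a b a+0≡b with climb-end a b a+0≡b
  ... | ≡.refl = refl
  winding-climb (suc d) a b a+d≡b with injected? a (climb-below d a b a+d≡b)
  ... | injected i = trans (+-identityˡ _) (winding-climb d (suc i) b (climb-next d i b a+d≡b))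

  winding-finishCycle : ∀ j d (k : Fin (m j)) k+d≡m → winding (finishCycle j d k k+d≡m) ≈ w j
  winding-finishCycle j zero    k _     = +-identityʳ _
  winding-finishCycle j (suc d) k k+d≡m =
    trans (+-identityˡ _) (winding-finishCycle j d (fromℕ< (cycle-below d k k+d≡m)) (cycle-next d k k+d≡m))

  winding-backwardRoute : ∀ j 1≤m a b b<a → winding (BackwardRoute.route j 1≤m a b b<a) ≈ w j
  winding-backwardRoute j 1≤m a b b<a = begin
      winding (up ++ₚ around ++ₚ down)        ≈⟨ winding-++ up (around ++ₚ down) ⟩
      winding up + winding (around ++ₚ down)
        ≈⟨ +-cong (winding-climb (n ℕ.∸ toℕ a) a (fromℕ n) a+rest≡n) (winding-++ around down) ⟩
      0# + (winding around + winding down)    ≈⟨ +-identityˡ _ ⟩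
      winding around + winding down
        ≈⟨ +-cong (trans (+-identityˡ _) (winding-finishCycle j (m j ℕ.∸ 1) k₀ k₀+rest≡m))
                  (winding-climb (toℕ b) zero b ≡.refl) ⟩
      w j + 0#                                ≈⟨ +-identityʳ _ ⟩
      w j                                     ∎
    where open BackwardRoute j 1≤m a b b<a

  module Distances {ℓ′} (_≤_ : Carrier → Carrier → Set ℓ′) (≤-isPartialOrder : IsPartialOrder _≈_ _≤_)
                   (+-monoˡ-≤ : ∀ {x y} z → x ≤ y → (x + z) ≤ (y + z))
                   (j₀ : Fin r) (w₀-minimal : ∀ j → w j₀ ≤ w j) (1≤m : ∀ j → 1 ℕ.≤ m j) where
    open IsPartialOrder ≤-isPartialOrder using (antisym; ≲-respʳ-≈)

    jump : V → Carrier
    jump (u _)   = w j₀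
    jump (v j _) = w j

    private
      pathWeight-winding : ∀ {x y : V} (p : Path x y) {t} → winding p ≈ t →
                           pathWeight p ≈ (t + potential y) - potential x
      pathWeight-winding {x} {y} p {t} winding≈t = begin
        pathWeight p                             ≈⟨ pathWeight-potential p ⟩
        (potential y - potential x) + winding p  ≈⟨ +-congˡ winding≈t ⟩
        (potential y - potential x) + t
          ≈⟨ solve 3 (λ a b t → (b :- a) :+ t := (t :+ b) :- a) refl _ _ t ⟩
        (t + potential y) - potential x          ∎

      backward-distance : ∀ x y {d} → ¬ Forward x y → IsMinPathWeight _≤_ x y d →
                          d ≈ (jump x + potential y) - potential x
      backward-distance (v j k) y ¬f ((p , p-simple , p≈d) , _) =
        trans (sym p≈d) (pathWeight-winding p (SimpleWinding.when-backward (simpleWinding p p-simple) ¬f))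
      backward-distance (u a) (v _ _) ¬f _ = ⊥-elim (¬f u→v)
      backward-distance (u a) (u b) {d} ¬f ((p , p-simple , p≈d) , minimal) = antisym d≤route route≤d
        where
        b<a : toℕ b ℕ.< toℕ a
        b<a = ℕ.≰⇒> (¬f ∘ u≤u)
        open BackwardRoute j₀ (1≤m j₀) a b b<a
        d≤route : d ≤ ((w j₀ + potential (u b)) - potential (u a))
        d≤route = ≲-respʳ-≈ (pathWeight-winding route (winding-backwardRoute j₀ (1≤m j₀) a b b<a))
                            (minimal route route-simple)
        route≤d : ((w j₀ + potential (u b)) - potential (u a)) ≤ d
        route≤d with SimpleWinding.when-backward (simpleWinding p p-simple) ¬f
        ... | j , winding≈w = ≲-respʳ-≈ (sym (trans (sym p≈d) (pathWeight-winding p winding≈w)))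
                                (+-monoˡ-≤ _ (+-monoˡ-≤ _ (w₀-minimal j)))

    distance-formula : ∀ x y d → (x ≡ y → d ≈ 0#) → (x ≢ y → IsMinPathWeight _≤_ x y d) →
                       d ≈ ((if does (forward? x y) then 0# else jump x) + potential y) - potential x
    distance-formula x y d d-diag d-min with forward? x y | x ≟ᵥ y
    ... | yes _ | yes ≡.refl =
      trans (d-diag ≡.refl) (solve 1 (λ a → con (+ 0) := (con (+ 0) :+ a) :- a) refl (potential x))
    ... | yes f | no x≢y with d-min x≢y
    ...   | (p , p-simple , p≈d) , _ =
      trans (sym p≈d) (pathWeight-winding p (SimpleWinding.when-forward (simpleWinding p p-simple) f))
    distance-formula x x d d-diag d-min | no ¬f | yes ≡.refl = ⊥-elim (¬f (forward-refl x))
    distance-formula x y d d-diag d-min | no ¬f | no x≢y = backward-distance x y ¬f (d-min x≢y)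

    prodF-jumps : prodF R (n ℕ.+ total r m) (λ a → - jump (enum n r m (suc a)))
                    ≈ sgn R (n ℕ.+ total r m) * (pow R (w j₀) n * prodF R r (λ j → pow R (w j) (m j)))
    prodF-jumps = begin
      prodF R (n ℕ.+ total r m) (λ a → - jump (enum n r m (suc a)))
        ≈⟨ prodF-enum (λ x → - jump x) ⟩
      prodF R n (λ _ → - w j₀) * prodF R (total r m) (λ k → - w (proj₁ (vblock r m k)))
        ≈⟨ *-cong (trans (prodF-const n (- w j₀)) (pow-neg (w j₀) n)) (prodF-vblock r m (λ j → - w j)) ⟩
      (sgn R n * pow R (w j₀) n) * prodF R r (λ j → pow R (- w j) (m j))
        ≈⟨ *-congˡ (trans (prodF-cong r (λ j → pow-neg (w j) (m j))) (prodF-sgn r m _)) ⟩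
      (sgn R n * pow R (w j₀) n) * (sgn R (total r m) * prodF R r (λ j → pow R (w j) (m j)))
        ≈⟨ *-interchange _ _ _ _ ⟩
      (sgn R n * sgn R (total r m)) * (pow R (w j₀) n * prodF R r (λ j → pow R (w j) (m j)))
        ≈⟨ *-congʳ (sgn-+ n (total r m)) ⟨
      sgn R (n ℕ.+ total r m) * (pow R (w j₀) n * prodF R r (λ j → pow R (w j) (m j))) ∎

mainTheorem2 : ∀ {c ℓ ℓ′ : Level} (R : CommutativeRing c ℓ) →
    let open CommutativeRing R renaming (Carrier to X) in
    (_≤_ : X → X → Set ℓ′) → IsTotalOrder _≈_ _≤_ →
    (∀ {x y} z → x ≤ y → (x + z) ≤ (y + z)) →
    (n r : ℕ) (m : Fin r → ℕ) →
    (hn : 1 ℕ.≤ n) (hr : 0 ℕ.< r) (hm : ∀ j → 1 ℕ.≤ m j) →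
    (W : Fin n → X) (Wv : (j : Fin r) → Fin (suc (m j)) → X) →
    let open Weighted R {n} {r} {m} W Wv in
    (∀ j k → j Fin.≤ k → w j ≤ w k) →
    (D : Matrix R (suc n ℕ.+ total r m)) → IsDistanceMatrix _≤_ D →
    cof R (n ℕ.+ total r m) D
      ≈ sgn R (n ℕ.+ total r m)
          * (pow R (w (fromℕ< hr)) n
             * prodF R r (λ j → pow R (w j) (m j)))
mainTheorem2 R _≤_ ≤-isTotalOrder +-monoˡ-≤ n r m _ 0<r 1≤m W Wv w-mono D D-distances =
  trans (cof-jumpsModuloPotential (n ℕ.+ total r m) D (λ a b → Forward (vertex a) (vertex b))
           (λ a b → forward? (vertex a) (vertex b)) (jump ∘ vertex) (potential ∘ vertex)
           (λ b → forward-from-u₀ (vertex b)) (λ a → forward-refl (vertex a))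
           (λ {a} {b} a⊑b → ≡.subst₂ ℕ._≤_ (position-enum a) (position-enum b) (position-mono a⊑b))
           (λ a b → distance-formula (vertex a) (vertex b) (D a b)
                      (proj₁ (D-distances a b)) (proj₂ (D-distances a b))))
        prodF-jumps
  where
  open CommutativeRing R using (trans)
  open Cofactors R
  open DCDigraph {n} {r} {m}
  open WeightedDC R W Wv
  open Weighted R W Wv using (w)
  vertex : Fin (suc n ℕ.+ total r m) → V
  vertex = enum n r m
  j₀ : Fin r
  j₀ = fromℕ< 0<r
  w₀-minimal : ∀ j → w j₀ ≤ w j
  w₀-minimal j = w-mono j₀ j (≡.subst (ℕ._≤ toℕ j) (≡.sym (Fin.toℕ-fromℕ< 0<r)) ℕ.z≤n)
  open Distances _≤_ (IsTotalOrder.isPartialOrder ≤-isTotalOrder) +-monoˡ-≤ j₀ w₀-minimal 1≤m
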